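{- As $n\to\infty$, $\operatorname{lc}_{\mathfrak{CB}}(G_{P(1,2;n)})=\Theta(\log n)$.
   Context: $P(1,2;n)$ is the subposet of the Boolean lattice of subsets of $[n]=\{1,\dots,n\}$ (ordered by inclusion) induced by all $1$-element and all $2$-element subsets. $G_{P(1,2;n)}$ is the bipartite graph whose parts are the $1$-element subsets and the $2$-element subsets, where $\{a\}$ and $\{b,c\}$ are adjacent iff $\{a\}\not\subseteq\{b,c\}$, i.e., iff $a\notin\{b,c\}$. For a class $\mathfrak{F}$ of graphs and a graph $H$, an $\mathfrak{F}$-covering of $H$ is a set of subgraphs $G_1,\dots,G_t$ of $H$, each in $\mathfrak{F}$, whose union is $H$; it is $k$-local if every vertex lies in at most $k$ of the $G_i$; $\operatorname{lc}_{\mathfrak{F}}(H)$ is the least such $k$. $\mathfrak{CB}$ is the class of complete bipartite graphs. -}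

module Defs where

open import Data.Nat using (ℕ; zero; suc; _+_; _*_; _≤_)
open import Data.Nat.Logarithm using (⌊log₂_⌋)
open import Data.Fin using (Fin; _<_)
open import Data.Bool using (Bool; true; false; if_then_else_)
open import Data.List using (List; []; _∷_)
open import Data.List.Relation.Unary.Any using (Any)
open import Data.Product using (Σ; _×_; ∃)
open import Relation.Binary.PropositionalEquality using (_≡_; _≢_)

-- Vertices of G_{P(1,2;n)} over [n] = Fin n:
--   singleton {a}   is represented by a : Fin n
--   pair {b,c}      is represented by (b , c) with b < c.
-- A complete bipartite subgraph of G_{P(1,2;n)}: a set L of singletons
-- and a set R of pairs (R b c is only consulted for b < c) such that every
-- singleton in L is adjacent (in G_{P(1,2;n)}) to every pair in R, i.e.
-- a ∉ {b,c}.  Its vertex set is L ∪ R and its edge set is L × R.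
record Biclique (n : ℕ) : Set where
  field
    L : Fin n → Bool
    R : Fin n → Fin n → Bool
    complete : ∀ a b c → b < c → L a ≡ true → R b c ≡ true →
               (a ≢ b) × (a ≢ c)
open Biclique public

record IsCBCovering (n : ℕ) (cs : List (Biclique n)) : Set where
  field
    coverSingleton : ∀ a → Any (λ g → L g a ≡ true) cs
    coverPair      : ∀ b c → b < c → Any (λ g → R g b c ≡ true) cs
    coverEdge      : ∀ a b c → b < c → a ≢ b → a ≢ c →
                     Any (λ g → (L g a ≡ true) × (R g b c ≡ true)) cs

countL : ∀ {n} → List (Biclique n) → Fin n → ℕ
countL [] a = 0
countL (g ∷ gs) a = (if L g a then 1 else 0) + countL gs a

countR : ∀ {n} → List (Biclique n) → Fin n → Fin n → ℕ
countR [] b c = 0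
countR (g ∷ gs) b c = (if R g b c then 1 else 0) + countR gs b c

IsLocal : ∀ {n} → ℕ → List (Biclique n) → Set
IsLocal {n} k cs = (∀ a → countL cs a ≤ k) × (∀ b c → b < c → countR cs b c ≤ k)

IsLcCB : ℕ → ℕ → Set
IsLcCB n k =
  (Σ (List (Biclique n)) λ cs → IsCBCovering n cs × IsLocal k cs)
  × (∀ (cs : List (Biclique n)) k' → IsCBCovering n cs → IsLocal k' cs → k ≤ k')

module Submission where

-- Upper bound: write the vertices [n] in binary.  For every level j and every block of
-- numbers sharing their digits above j, take the biclique between the half-block with a
-- given digit j and the pairs avoiding that half but meeting the block.  Every vertex lies
-- in O(1) of these per level, and a ∉ {b , c} is separated from {b , c} at the first level
-- where a's block contains b or c, so O(log n) levels suffice.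
--
-- Lower bound: choose at random one side of every biclique of a k-local covering.  For
-- i < n/2 let E_i be the event that every biclique containing {2i} chose its singleton side
-- and every biclique containing {2i , 2i+1} chose its pair side.  No biclique contains both,
-- so P(E_i) ≥ 4^-k; a biclique covering the edge {2i}—{2j , 2j+1} makes E_i and E_j disjoint.
-- Hence n/2 ≤ 4^k.
--
-- Constructively the least k exists because k-local coverings are decidable: dropping empty
-- bicliques bounds the length of a k-local covering, and a biclique is determined by
-- finitely many bits.

open import Defs
open import Data.Bool using (Bool; true; false; if_then_else_; _∧_; _∨_; not)
import Data.Bool as Bool
open import Data.Bool.ListAction using (any)
open import Data.Bool.Properties using (∧-identityʳ; ∨-zeroʳ)
open import Data.Empty using (⊥-elim)
open import Data.Fin using (Fin; toℕ; inject≤; combine; remQuot)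
import Data.Fin as Fin
open import Data.Fin.Patterns using (0F; 1F; 2F)
import Data.Fin.Properties as Fin
open import Data.Fin.Subset using (Subset)
open import Data.Fin.Subset.Properties using (anySubset?)
open import Data.List using (List; []; _∷_; _++_; length; map; filter; filterᵇ; downFrom; allFin; cartesianProduct)
open import Data.List.Membership.Propositional using (_∈_; lose)
open import Data.List.Membership.Propositional.Properties
  using (∈-++⁺ˡ; ∈-++⁺ʳ; ∈-map⁺; ∈-allFin; ∈-cartesianProduct⁺)
open import Data.List.Properties using (length-map; length-tabulate)
open import Data.List.Relation.Binary.Pointwise using (Pointwise; Any-resp-Pointwise)
import Data.List.Relation.Binary.Pointwise as Pointwise
open import Data.List.Relation.Unary.All using (All; []; _∷_)
import Data.List.Relation.Unary.All as All
import Data.List.Relation.Unary.All.Properties as All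
open import Data.List.Relation.Unary.AllPairs using (AllPairs; []; _∷_)
import Data.List.Relation.Unary.AllPairs.Properties as AllPairs
open import Data.List.Relation.Unary.Any using (Any; here; there)
import Data.List.Relation.Unary.Any as Any
open import Data.Nat using (ℕ; zero; suc; _+_; _*_; _^_; _≤_; _<_; z≤n; s≤s; z<s; _≟_; _≤?_; ⌊_/2⌋)
open import Data.Nat.DivMod using (_/_; _mod_; _divMod_; DivMod; m/n≤m; m<n*o⇒m/o<n)
open import Data.Nat.ListAction using (sum)
open import Data.Nat.Logarithm using (⌊log₂_⌋; ⌊log₂⌋-mono-≤; ⌊log₂[2^n]⌋≡n; ⌊log₂⌊n/2⌋⌋≡⌊log₂n⌋∸1)
open import Data.Nat.Properties
open import Data.Nat.Tactic.RingSolver using (solve-∀)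
open import Data.Product using (Σ; ∃; _×_; _,_; proj₁; proj₂; uncurry)
open import Data.Product.Properties using (,-injective)
open import Data.Sum using (_⊎_; inj₁; inj₂; [_,_]′)
import Data.Sum as Sum
open import Data.Vec using (lookup; tabulate)
open import Data.Vec.Properties using (lookup∘tabulate)
open import Function using (_∘_; case_of_)
open import Level using (0ℓ)
open import Relation.Binary.PropositionalEquality
open import Relation.Nullary using (¬_; Dec; does; yes; no; contradiction)
open import Relation.Nullary.Decidable using (map′; dec-true; dec-false; _×-dec_; _⊎-dec_; _→-dec_; ¬?)
open import Relation.Unary using (Pred; Decidable)

module _ {P : Pred ℕ 0ℓ} (P? : Decidable P) where

  Least : ℕ → Set
  Least k = P k × (∀ {m} → P m → k ≤ m)

  private
    leastBelow : ∀ n → (∀ {m} → m < n → ¬ P m) ⊎ ∃ Least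
    leastBelow zero = inj₁ λ ()
    leastBelow (suc n) with leastBelow n
    ... | inj₂ least = inj₂ least
    ... | inj₁ none with P? n
    ...   | yes pn = inj₂ (n , pn , λ pm → ≮⇒≥ λ m<n → none m<n pm)
    ...   | no ¬pn = inj₁ λ m<1+n → [ none , (λ { refl → ¬pn }) ]′ (m<1+n⇒m<n∨m≡n m<1+n)

  least : ∀ {n} → P n → ∃ Least
  least {n} pn with leastBelow (suc n)
  ... | inj₂ l    = l
  ... | inj₁ none = ⊥-elim (none (n<1+n n) pn)

  transition : ∀ M → ¬ P 0 → P M → ∃ λ j → j < M × ¬ P j × P (suc j)
  transition zero    ¬p₀ pₘ = ⊥-elim (¬p₀ pₘ)
  transition (suc M) ¬p₀ p₁₊ₘ with P? M
  ... | no ¬pₘ = M , n<1+n M , ¬pₘ , p₁₊ₘ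
  ... | yes pₘ with transition M ¬p₀ pₘ
  ...   | j , j<M , step = j , m<n⇒m<1+n j<M , step

shift : ℕ → ℕ → ℕ
shift zero    x = x
shift (suc j) x = shift j x / 2

digit : ℕ → ℕ → Fin 2
digit j x = shift j x mod 2

shift≤ : ∀ j x → shift j x ≤ x
shift≤ zero    x = ≤-refl
shift≤ (suc j) x = ≤-trans (m/n≤m (shift j x) 2) (shift≤ j x)

shift<-*2^ : ∀ j {x y} → x < y * 2 ^ j → shift j x < y
shift<-*2^ zero    {x} {y} x<y = subst (x <_) (*-identityʳ y) x<y
shift<-*2^ (suc j) {x} {y} x<y =
  m<n*o⇒m/o<n (shift<-*2^ j (subst (x <_) (sym (*-assoc y 2 (2 ^ j))) x<y))

shift-<2^ : ∀ j {x} → x < 2 ^ j → shift j x ≡ 0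
shift-<2^ j {x} x<2^j = n<1⇒n≡0 (shift<-*2^ j (subst (x <_) (sym (*-identityˡ (2 ^ j))) x<2^j))

shift-injective : ∀ j {x y} → digit j x ≡ digit j y → shift (suc j) x ≡ shift (suc j) y →
                  shift j x ≡ shift j y
shift-injective j {x} {y} d≡ s≡ = begin
  shift j x                              ≡⟨ DivMod.property (shift j x divMod 2) ⟩
  toℕ (digit j x) + shift (suc j) x * 2  ≡⟨ cong₂ (λ u v → toℕ u + v * 2) d≡ s≡ ⟩
  toℕ (digit j y) + shift (suc j) y * 2  ≡⟨ DivMod.property (shift j y divMod 2) ⟨
  shift j y                              ∎
  where open ≡-Reasoning

n<2^[1+⌊log₂n⌋] : ∀ n → n < 2 ^ suc ⌊log₂ n ⌋
n<2^[1+⌊log₂n⌋] n = ≰⇒> λ 2^[1+⌊log₂n⌋]≤n → 1+n≰n (begin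
  suc ⌊log₂ n ⌋              ≡⟨ ⌊log₂[2^n]⌋≡n (suc ⌊log₂ n ⌋) ⟨
  ⌊log₂ 2 ^ suc ⌊log₂ n ⌋ ⌋  ≤⟨ ⌊log₂⌋-mono-≤ 2^[1+⌊log₂n⌋]≤n ⟩
  ⌊log₂ n ⌋                  ∎)
  where open ≤-Reasoning

⌊log₂n⌋≤1+⌊log₂⌊n/2⌋⌋ : ∀ n → ⌊log₂ n ⌋ ≤ suc ⌊log₂ ⌊ n /2⌋ ⌋
⌊log₂n⌋≤1+⌊log₂⌊n/2⌋⌋ n =
  subst (λ x → ⌊log₂ n ⌋ ≤ suc x) (sym (⌊log₂⌊n/2⌋⌋≡⌊log₂n⌋∸1 n)) (m≤n+m∸n _ 1)

1≤⌊log₂n⌋ : ∀ {n} → 2 ≤ n → 1 ≤ ⌊log₂ n ⌋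
1≤⌊log₂n⌋ {n} 2≤n = subst (_≤ ⌊log₂ n ⌋) (⌊log₂[2^n]⌋≡n 1) (⌊log₂⌋-mono-≤ 2≤n)

4[1+m]≤8m : ∀ {m} → 1 ≤ m → 4 * suc m ≤ 8 * m
4[1+m]≤8m {suc j} _ = subst (4 * suc (suc j) ≤_) (sym (8[1+j]≡4[2+j]+4j j)) (m≤m+n _ (4 * j))
  where
  8[1+j]≡4[2+j]+4j : ∀ j → 8 * suc j ≡ 4 * suc (suc j) + 4 * j
  8[1+j]≡4[2+j]+4j = solve-∀

⌊n/2⌋*2≤n : ∀ n → ⌊ n /2⌋ * 2 ≤ n
⌊n/2⌋*2≤n n = begin
  ⌊ n /2⌋ * 2              ≡⟨ *-comm ⌊ n /2⌋ 2 ⟩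
  ⌊ n /2⌋ + (⌊ n /2⌋ + 0)  ≡⟨ cong (⌊ n /2⌋ +_) (+-identityʳ _) ⟩
  ⌊ n /2⌋ + ⌊ n /2⌋        ≤⟨ +-monoʳ-≤ ⌊ n /2⌋ (⌊n/2⌋≤⌈n/2⌉ n) ⟩
  ⌊ n /2⌋ + _              ≡⟨ ⌊n/2⌋+⌈n/2⌉≡n n ⟩
  n                        ∎
  where open ≤-Reasoning

ind : Bool → ℕ
ind b = if b then 1 else 0

ind-∧ : ∀ x y → ind (x ∧ y) ≤ ind x
ind-∧ false y     = z≤n
ind-∧ true  false = z≤n
ind-∧ true  true  = ≤-refl

ind-∨ : ∀ x y → ind (x ∨ y) ≤ ind x + ind y
ind-∨ false y = ≤-refl
ind-∨ true  y = s≤s z≤n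

count : {A : Set} → (A → Bool) → List A → ℕ
count p []       = 0
count p (x ∷ xs) = ind (p x) + count p xs

count-false : ∀ {A : Set} (xs : List A) → count (λ _ → false) xs ≡ 0
count-false []       = refl
count-false (_ ∷ xs) = count-false xs

count-∨≤ : ∀ {A : Set} (p q : A → Bool) xs → count (λ x → p x ∨ q x) xs ≤ count p xs + count q xs
count-∨≤ p q []       = z≤n
count-∨≤ p q (x ∷ xs) = begin
  ind (p x ∨ q x) + count (λ x → p x ∨ q x) xs        ≤⟨ +-mono-≤ (ind-∨ (p x) (q x)) (count-∨≤ p q xs) ⟩
  ind (p x) + ind (q x) + (count p xs + count q xs)  ≡⟨ +-+-swap (ind (p x)) (ind (q x)) _ _ ⟩
  count p (x ∷ xs) + count q (x ∷ xs)                ∎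
  where
  open ≤-Reasoning
  +-+-swap : ∀ a b c d → a + b + (c + d) ≡ a + c + (b + d)
  +-+-swap = solve-∀

count-≟-downFrom≡0 : ∀ {v m} → m ≤ v → count (λ P → does (v ≟ P)) (downFrom m) ≡ 0
count-≟-downFrom≡0 {v} {zero}  _ = refl
count-≟-downFrom≡0 {v} {suc m} 1+m≤v rewrite dec-false (v ≟ m) (λ { refl → <-irrefl refl 1+m≤v }) =
  count-≟-downFrom≡0 (<⇒≤ 1+m≤v)

count-≟-downFrom≤1 : ∀ v m → count (λ P → does (v ≟ P)) (downFrom m) ≤ 1
count-≟-downFrom≤1 v zero    = z≤n
count-≟-downFrom≤1 v (suc m) with v ≟ m
... | yes refl rewrite dec-true (v ≟ v) refl = ≤-reflexive (cong suc (count-≟-downFrom≡0 {v} ≤-refl))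
... | no  v≢m  rewrite dec-false (v ≟ m) v≢m = count-≟-downFrom≤1 v m

length-filterᵇ : ∀ {A : Set} (p : A → Bool) xs → length (filterᵇ p xs) ≡ count p xs
length-filterᵇ p []       = refl
length-filterᵇ p (x ∷ xs) with p x
... | true  = cong suc (length-filterᵇ p xs)
... | false = length-filterᵇ p xs

Any-filterᵇ : ∀ {A : Set} {P : A → Set} (p : A → Bool) → (∀ {x} → P x → p x ≡ true) →
              ∀ {xs} → Any P xs → Any P (filterᵇ p xs)
Any-filterᵇ p P⇒p {x ∷ xs} (here px) rewrite P⇒p px = here px
Any-filterᵇ p P⇒p {x ∷ xs} (there pxs) with p x
... | true  = there (Any-filterᵇ p P⇒p pxs)
... | false = Any-filterᵇ p P⇒p pxs

module _ {E V : Set} (_∋_ : E → V → Bool) where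

  meets : List V → E → Bool
  meets vs g = any (g ∋_) vs

  meets-∈ : ∀ {g v vs} → v ∈ vs → g ∋ v ≡ true → meets vs g ≡ true
  meets-∈ (here refl) g∋v rewrite g∋v = refl
  meets-∈ {g} {vs = w ∷ _} (there v∈vs) g∋v = trans (cong (g ∋ w ∨_) (meets-∈ v∈vs g∋v)) (∨-zeroʳ _)

  count-meets≤ : ∀ {k} vs cs → All (λ v → count (_∋ v) cs ≤ k) vs → count (meets vs) cs ≤ length vs * k
  count-meets≤ []       cs []         = ≤-reflexive (count-false cs)
  count-meets≤ (v ∷ vs) cs (≤k ∷ ≤ks) =
    ≤-trans (count-∨≤ (_∋ v) (meets vs) cs) (+-mono-≤ ≤k (count-meets≤ vs cs ≤ks))

AllPairs-restrict : {A : Set} {P : A → Set} {R S : A → A → Set} →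
                    (∀ {x y} → P x → P y → R x y → S x y) →
                    ∀ {xs} → All P xs → AllPairs R xs → AllPairs S xs
AllPairs-restrict f []         []         = []
AllPairs-restrict f (px ∷ pxs) (rs ∷ rss) =
  All.zipWith (λ (py , r) → f px py r) (pxs , rs) ∷ AllPairs-restrict f pxs rss

length*≤sum* : {A : Set} {X Y : ℕ} (f : A → ℕ) (xs : List A) →
               All (λ x → X ≤ f x * Y) xs → length xs * X ≤ sum (map f xs) * Y
length*≤sum* f []       []         = z≤n
length*≤sum* {X = X} {Y} f (x ∷ xs) (≤fx*Y ∷ ≤fxs*Y) = begin
  X + length xs * X             ≤⟨ +-mono-≤ ≤fx*Y (length*≤sum* f xs ≤fxs*Y) ⟩
  f x * Y + sum (map f xs) * Y  ≡⟨ *-distribʳ-+ Y (f x) _ ⟨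
  sum (map f (x ∷ xs)) * Y      ∎
  where open ≤-Reasoning

-- Tuza's inequality ∑_d 2^-(|A_d| + |B_d|) ≤ 1 for the disjoint, cross-intersecting pairs
-- A_d = {g ∈ cs | α d g}, B_d = {g ∈ cs | β d g}, multiplied through by 2^|cs|.

module CrossingPairs {D E : Set} (α β : D → E → Bool)
                     (disjoint : ∀ d g → α d g ≡ true → β d g ≡ false) where

  Reaches : List E → D → D → Set
  Reaches cs d d′ = Any (λ g → α d g ≡ true × β d′ g ≡ true) cs

  Crossing : List E → D → D → Set
  Crossing cs d d′ = Reaches cs d d′ × Reaches cs d′ d

  free : List E → D → ℕ
  free []       d = 0
  free (g ∷ gs) d = (if α d g ∨ β d g then 0 else 1) + free gs d

  weight : List E → D → ℕ
  weight cs d = 2 ^ free cs d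

  length≡free+counts : ∀ cs d → length cs ≡ free cs d + (count (α d) cs + count (β d) cs)
  length≡free+counts []       d = refl
  length≡free+counts (g ∷ gs) d with α d g in αdg | β d g in βdg | length≡free+counts gs d
  ... | true  | true  | _  = contradiction (trans (sym βdg) (disjoint d g αdg)) λ ()
  ... | true  | false | ih = trans (cong suc ih) (sym (+-suc (free gs d) _))
  ... | false | true  | ih = trans (cong suc ih) (sym (trans (cong (free gs d +_) (+-suc (count (α d) gs) _))
                                                              (+-suc (free gs d) _)))
  ... | false | false | ih = cong suc ih

  private
    off : (D → E → Bool) → E → D → Set
    off γ g d = γ d g ≡ false

    off? : ∀ γ g → Decidable (off γ g)
    off? γ g d = γ d g Bool.≟ false

    weightOff : (D → E → Bool) → E → List E → List D → ℕ
    weightOff γ g gs ds = sum (map (weight gs) (filter (off? γ g) ds))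

    -- Each member g either puts d on one side (weight unchanged, d survives on one branch)
    -- or misses d (weight doubled, d survives on both branches).
    weight-split : ∀ g gs ds → sum (map (weight (g ∷ gs)) ds) ≡ weightOff β g gs ds + weightOff α g gs ds
    weight-split g gs []       = refl
    weight-split g gs (d ∷ ds) with α d g in αdg | β d g in βdg | weight-split g gs ds
    ... | true  | true  | _  = contradiction (trans (sym βdg) (disjoint d g αdg)) λ ()
    ... | true  | false | ih = trans (cong (weight gs d +_) ih) (sym (+-assoc (weight gs d) _ _))
    ... | false | true  | ih =
      trans (cong (weight gs d +_) ih) (+-left-comm (weight gs d) (weightOff β g gs ds) (weightOff α g gs ds))
      where
      +-left-comm : ∀ a b c → a + (b + c) ≡ b + (a + c)
      +-left-comm = solve-∀
    ... | false | false | ih =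
      trans (cong (2 * weight gs d +_) ih) (interleave (weight gs d) (weightOff β g gs ds) (weightOff α g gs ds))
      where
      interleave : ∀ w s t → 2 * w + (s + t) ≡ (w + s) + (w + t)
      interleave = solve-∀

  weight-sum≤ : ∀ cs {ds} → AllPairs (Crossing cs) ds → sum (map (weight cs) ds) ≤ 2 ^ length cs
  weight-sum≤ []       []                   = z≤n
  weight-sum≤ []       (_ ∷ [])             = ≤-refl
  weight-sum≤ []       (((() , _) ∷ _) ∷ _)
  weight-sum≤ (g ∷ gs) {ds} crossing = begin
    sum (map (weight (g ∷ gs)) ds)         ≡⟨ weight-split g gs ds ⟩
    weightOff β g gs ds + weightOff α g gs ds
      ≤⟨ +-mono-≤ (weight-sum≤ gs (keep β drop-β)) (weight-sum≤ gs (keep α drop-α)) ⟩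
    2 ^ length gs + 2 ^ length gs          ≡⟨ cong (2 ^ length gs +_) (+-identityʳ _) ⟨
    2 ^ length (g ∷ gs)                    ∎
    where
    open ≤-Reasoning
    Drop : (D → E → Bool) → Set
    Drop γ = ∀ {d d′} → off γ g d → off γ g d′ → Crossing (g ∷ gs) d d′ → Crossing gs d d′
    keep : ∀ γ → Drop γ → AllPairs (Crossing gs) (filter (off? γ g) ds)
    keep γ drop = AllPairs-restrict drop (All.all-filter (off? γ g) ds) (AllPairs.filter⁺ (off? γ g) crossing)
    β-off : ∀ {d d′} → off β g d′ → ¬ (α d g ≡ true × β d′ g ≡ true)
    β-off off (_ , on) = contradiction (trans (sym on) off) λ ()
    α-off : ∀ {d d′} → off α g d → ¬ (α d g ≡ true × β d′ g ≡ true)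
    α-off off (on , _) = contradiction (trans (sym on) off) λ ()
    drop-β : Drop β
    drop-β βd βd′ (c , c′) = Any.tail (β-off βd′) c , Any.tail (β-off βd) c′
    drop-α : Drop α
    drop-α αd αd′ (c , c′) = Any.tail (α-off αd) c , Any.tail (α-off αd′) c′

  crossing-length≤ : ∀ cs {ds} k → AllPairs (Crossing cs) ds →
                     All (λ d → count (α d) cs ≤ k × count (β d) cs ≤ k) ds →
                     length ds ≤ 2 ^ (k + k)
  crossing-length≤ cs {ds} k crossing bounded = *-cancelʳ-≤ (length ds) (2 ^ (k + k)) (2 ^ length cs)
    {{m^n≢0 2 (length cs)}} (begin
      length ds * 2 ^ length cs              ≤⟨ length*≤sum* (weight cs) ds (All.map weight-bound bounded) ⟩
      sum (map (weight cs) ds) * 2 ^ (k + k) ≤⟨ *-monoˡ-≤ (2 ^ (k + k)) (weight-sum≤ cs crossing) ⟩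
      2 ^ length cs * 2 ^ (k + k)            ≡⟨ *-comm (2 ^ length cs) _ ⟩
      2 ^ (k + k) * 2 ^ length cs            ∎)
    where
    open ≤-Reasoning
    weight-bound : ∀ {d} → count (α d) cs ≤ k × count (β d) cs ≤ k → 2 ^ length cs ≤ weight cs d * 2 ^ (k + k)
    weight-bound {d} (αk , βk) = begin
      2 ^ length cs                                        ≡⟨ cong (2 ^_) (length≡free+counts cs d) ⟩
      2 ^ (free cs d + (count (α d) cs + count (β d) cs))  ≡⟨ ^-distribˡ-+-* 2 (free cs d) _ ⟩
      weight cs d * 2 ^ (count (α d) cs + count (β d) cs)  ≤⟨ *-monoʳ-≤ (weight cs d) (^-monoʳ-≤ 2 (+-mono-≤ αk βk)) ⟩
      weight cs d * 2 ^ (k + k)                            ∎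

Searchable : Set → Set₁
Searchable A = ∀ {P : Pred A 0ℓ} → Decidable P → Dec (∃ P)

searchable-× : ∀ {A B} → Searchable A → Searchable B → Searchable (A × B)
searchable-× search-A search-B P? =
  map′ (λ (a , b , p) → (a , b) , p) (λ ((a , b) , p) → a , b , p)
       (search-A λ a → search-B λ b → P? (a , b))

search-length≤ : ∀ {A} → Searchable A → ∀ m {P : Pred (List A) 0ℓ} → Decidable P →
                 Dec (∃ λ xs → length xs ≤ m × P xs)
search-length≤ search zero    P? = map′ (λ p → [] , z≤n , p) (λ { ([] , _ , p) → p }) (P? [])
search-length≤ search (suc m) {P} P? =
  map′ to from (P? [] ⊎-dec search λ x → search-length≤ search m (P? ∘ (x ∷_)))
  where
  to : P [] ⊎ (∃ λ x → ∃ λ xs → length xs ≤ m × P (x ∷ xs)) → ∃ λ xs → length xs ≤ suc m × P xs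
  to (inj₁ p)                 = [] , z≤n , p
  to (inj₂ (x , xs , ≤m , p)) = x ∷ xs , s≤s ≤m , p
  from : (∃ λ xs → length xs ≤ suc m × P xs) → P [] ⊎ (∃ λ x → ∃ λ xs → length xs ≤ m × P (x ∷ xs))
  from ([]     , _      , p) = inj₁ p
  from (x ∷ xs , s≤s ≤m , p) = inj₂ (x , xs , ≤m , p)

private variable n : ℕ

LocalCovering : ℕ → ℕ → Set
LocalCovering n k = Σ (List (Biclique n)) λ cs → IsCBCovering n cs × IsLocal k cs

outside : ∀ {r x y} → r ∧ not x ∧ not y ≡ true → x ≡ false × y ≡ false
outside {true} {false} {false} _ = refl , refl
outside {true} {false} {true}  ()
outside {true} {true}          ()
outside {false}                ()

biclique : (Fin n → Bool) → (Fin n → Fin n → Bool) → Biclique n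
biclique l r = record
  { L        = l
  ; R        = λ b c → r b c ∧ not (l b) ∧ not (l c)
  ; complete = λ a b c _ la rbc → let lb , lc = outside {r b c} {l b} {l c} rbc in
      (λ { refl → contradiction (trans (sym la) lb) λ () }) ,
      (λ { refl → contradiction (trans (sym la) lc) λ () })
  }

infix 4 _≈_
_≈_ : Biclique n → Biclique n → Set
g ≈ h = (∀ a → L g a ≡ L h a) × (∀ b c → b Fin.< c → R g b c ≡ R h b c)

biclique-L-R : (g : Biclique n) → g ≈ biclique (L g) (R g)
biclique-L-R g = (λ a → refl) , R≡
  where
  R≡ : ∀ b c → b Fin.< c → R g b c ≡ R g b c ∧ not (L g b) ∧ not (L g c)
  R≡ b c b<c with R g b c in rbc | L g b in lb | L g c in lc
  ... | false | _     | _     = refl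
  ... | true  | false | false = refl
  ... | true  | true  | _     = contradiction refl (proj₁ (complete g b b c b<c lb rbc))
  ... | true  | false | true  = contradiction refl (proj₂ (complete g c b c b<c lc rbc))

biclique-cong : ∀ {l l′ : Fin n → Bool} {r r′} → (∀ a → l a ≡ l′ a) → (∀ b c → r b c ≡ r′ b c) →
                biclique l r ≈ biclique l′ r′
biclique-cong l≡ r≡ = l≡ , λ b c _ → cong₂ _∧_ (r≡ b c) (cong₂ (λ x y → not x ∧ not y) (l≡ b) (l≡ c))

countL≡count : ∀ (cs : List (Biclique n)) a → countL cs a ≡ count (λ g → L g a) cs
countL≡count []       a = refl
countL≡count (g ∷ cs) a = cong (ind (L g a) +_) (countL≡count cs a)

countR≡count : ∀ (cs : List (Biclique n)) b c → countR cs b c ≡ count (λ g → R g b c) cs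
countR≡count []       b c = refl
countR≡count (g ∷ cs) b c = cong (ind (R g b c) +_) (countR≡count cs b c)

countL-++ : ∀ (cs ds : List (Biclique n)) a → countL (cs ++ ds) a ≡ countL cs a + countL ds a
countL-++ []       ds a = refl
countL-++ (g ∷ cs) ds a = trans (cong (ind (L g a) +_) (countL-++ cs ds a)) (sym (+-assoc (ind (L g a)) _ _))

countR-++ : ∀ (cs ds : List (Biclique n)) b c → countR (cs ++ ds) b c ≡ countR cs b c + countR ds b c
countR-++ []       ds b c = refl
countR-++ (g ∷ cs) ds b c =
  trans (cong (ind (R g b c) +_) (countR-++ cs ds b c)) (sym (+-assoc (ind (R g b c)) _ _))

countL-filterᵇ : ∀ p (cs : List (Biclique n)) a → countL (filterᵇ p cs) a ≤ countL cs a
countL-filterᵇ p []       a = z≤n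
countL-filterᵇ p (g ∷ cs) a with p g
... | true  = +-monoʳ-≤ (ind (L g a)) (countL-filterᵇ p cs a)
... | false = ≤-trans (countL-filterᵇ p cs a) (m≤n+m _ (ind (L g a)))

countR-filterᵇ : ∀ p (cs : List (Biclique n)) b c → countR (filterᵇ p cs) b c ≤ countR cs b c
countR-filterᵇ p []       b c = z≤n
countR-filterᵇ p (g ∷ cs) b c with p g
... | true  = +-monoʳ-≤ (ind (R g b c)) (countR-filterᵇ p cs b c)
... | false = ≤-trans (countR-filterᵇ p cs b c) (m≤n+m _ (ind (R g b c)))

1≤countL : ∀ (cs : List (Biclique n)) {a} → Any (λ g → L g a ≡ true) cs → 1 ≤ countL cs a
1≤countL (g ∷ cs) (here La) rewrite La = s≤s z≤n
1≤countL (g ∷ cs) (there a∈) = ≤-trans (1≤countL cs a∈) (m≤n+m _ _)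

Pointwise-covering : ∀ {cs ds : List (Biclique n)} → Pointwise _≈_ cs ds → IsCBCovering n cs → IsCBCovering n ds
Pointwise-covering cs≈ds covering = record
  { coverSingleton = λ a → Any-resp-Pointwise (λ (l , _) p → trans (sym (l a)) p) cs≈ds (coverSingleton a)
  ; coverPair      = λ b c b<c →
      Any-resp-Pointwise (λ (_ , r) p → trans (sym (r b c b<c)) p) cs≈ds (coverPair b c b<c)
  ; coverEdge      = λ a b c b<c a≢b a≢c →
      Any-resp-Pointwise (λ (l , r) (p , q) → trans (sym (l a)) p , trans (sym (r b c b<c)) q) cs≈ds
                         (coverEdge a b c b<c a≢b a≢c)
  }
  where open IsCBCovering covering

Pointwise-local : ∀ {k} {cs ds : List (Biclique n)} → Pointwise _≈_ cs ds → IsLocal k cs → IsLocal k ds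
Pointwise-local {k = k} cs≈ds (countL≤k , countR≤k) =
  (λ a → subst (_≤ k) (countL-resp cs≈ds a) (countL≤k a)) ,
  (λ b c b<c → subst (_≤ k) (countR-resp cs≈ds b<c) (countR≤k b c b<c))
  where
  countL-resp : ∀ {cs ds} → Pointwise _≈_ cs ds → ∀ a → countL cs a ≡ countL ds a
  countL-resp Pointwise.[]                a = refl
  countL-resp ((l , _) Pointwise.∷ cs≈ds) a = cong₂ _+_ (cong ind (l a)) (countL-resp cs≈ds a)
  countR-resp : ∀ {cs ds b c} → Pointwise _≈_ cs ds → b Fin.< c → countR cs b c ≡ countR ds b c
  countR-resp Pointwise.[]                b<c = refl
  countR-resp ((_ , r) Pointwise.∷ cs≈ds) b<c = cong₂ _+_ (cong ind (r _ _ b<c)) (countR-resp cs≈ds b<c)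

-- Upper bound: the binary construction

module Levels (n : ℕ) where

  parent : ℕ → Fin n → ℕ
  parent j a = shift (suc j) (toℕ a)

  inParent : ℕ → ℕ → Fin n → Bool
  inParent j P a = does (parent j a ≟ P)

  block : ℕ → ℕ → Fin 2 → Fin n → Bool
  block j P e a = inParent j P a ∧ does (digit j (toℕ a) Fin.≟ e)

  split : ℕ → ℕ → Fin 2 → Biclique n
  split j P e = biclique (block j P e) (λ b c → inParent j P b ∨ inParent j P c)

  level : ℕ → ℕ → List (Biclique n)
  level j zero    = []
  level j (suc P) = split j P 0F ∷ split j P 1F ∷ level j P

  levels : ℕ → List (Biclique n)
  levels zero    = []
  levels (suc j) = level j n ++ levels j

  block-count : ∀ j P a → ind (block j P 0F a) + ind (block j P 1F a) ≤ ind (inParent j P a)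
  block-count j P a with inParent j P a | digit j (toℕ a)
  ... | false | _  = z≤n
  ... | true  | 0F = ≤-refl
  ... | true  | 1F = ≤-refl

  countL-level : ∀ j m a → countL (level j m) a ≤ count (λ P → inParent j P a) (downFrom m)
  countL-level j zero    a = z≤n
  countL-level j (suc P) a = begin
    ind (block j P 0F a) + (ind (block j P 1F a) + countL (level j P) a)
      ≡⟨ +-assoc (ind (block j P 0F a)) _ _ ⟨
    ind (block j P 0F a) + ind (block j P 1F a) + countL (level j P) a
      ≤⟨ +-mono-≤ (block-count j P a) (countL-level j P a) ⟩
    count (λ P → inParent j P a) (downFrom (suc P)) ∎
    where open ≤-Reasoning

  countR-level : ∀ j m b c → countR (level j m) b c ≤
                 2 * (count (λ P → inParent j P b) (downFrom m) + count (λ P → inParent j P c) (downFrom m))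
  countR-level j zero    b c = z≤n
  countR-level j (suc P) b c = begin
    ind (R (split j P 0F) b c) + (ind (R (split j P 1F) b c) + countR (level j P) b c)
      ≤⟨ +-mono-≤ (pair-count 0F) (+-mono-≤ (pair-count 1F) (countR-level j P b c)) ⟩
    x + y + (x + y + 2 * (B + C)) ≡⟨ regroup x y B C ⟩
    2 * ((x + B) + (y + C))       ∎
    where
    open ≤-Reasoning
    x y B C : ℕ
    x = ind (inParent j P b)
    y = ind (inParent j P c)
    B = count (λ P → inParent j P b) (downFrom P)
    C = count (λ P → inParent j P c) (downFrom P)
    pair-count : ∀ e → ind (R (split j P e) b c) ≤ x + y
    pair-count e = ≤-trans (ind-∧ (inParent j P b ∨ inParent j P c) _) (ind-∨ (inParent j P b) _)
    regroup : ∀ x y B C → x + y + (x + y + 2 * (B + C)) ≡ 2 * ((x + B) + (y + C))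
    regroup = solve-∀

  countL-levels : ∀ M a → countL (levels M) a ≤ M
  countL-levels zero    a = z≤n
  countL-levels (suc j) a = begin
    countL (level j n ++ levels j) a            ≡⟨ countL-++ (level j n) (levels j) a ⟩
    countL (level j n) a + countL (levels j) a
      ≤⟨ +-mono-≤ (≤-trans (countL-level j n a) (count-≟-downFrom≤1 (parent j a) n)) (countL-levels j a) ⟩
    suc j                                       ∎
    where open ≤-Reasoning

  countR-levels : ∀ M b c → countR (levels M) b c ≤ 4 * M
  countR-levels zero    b c = z≤n
  countR-levels (suc j) b c = begin
    countR (level j n ++ levels j) b c              ≡⟨ countR-++ (level j n) (levels j) b c ⟩
    countR (level j n) b c + countR (levels j) b c
      ≤⟨ +-mono-≤ (≤-trans (countR-level j n b c) (*-monoʳ-≤ 2 (+-mono-≤ (count-≟-downFrom≤1 (parent j b) n)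
                                                                          (count-≟-downFrom≤1 (parent j c) n))))
                  (countR-levels j b c) ⟩
    4 + 4 * j                                       ≡⟨ *-suc 4 j ⟨
    4 * suc j                                       ∎
    where open ≤-Reasoning

  parent<n : ∀ j a → parent j a < n
  parent<n j a = ≤-<-trans (shift≤ (suc j) (toℕ a)) (Fin.toℕ<n a)

  ∈-level : ∀ {j P m} e → P < m → split j P e ∈ level j m
  ∈-level {m = suc m} e P<1+m with m<1+n⇒m<n∨m≡n P<1+m
  ... | inj₁ P<m = there (there (∈-level e P<m))
  ∈-level {m = suc m} 0F _ | inj₂ refl = here refl
  ∈-level {m = suc m} 1F _ | inj₂ refl = there (here refl)

  ∈-levels : ∀ {g j M} → j < M → g ∈ level j n → g ∈ levels M
  ∈-levels {M = suc M} j<1+M g∈ with m<1+n⇒m<n∨m≡n j<1+M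
  ... | inj₁ j<M  = ∈-++⁺ʳ (level M n) (∈-levels j<M g∈)
  ... | inj₂ refl = ∈-++⁺ˡ g∈

  own-block : ∀ j a → block j (parent j a) (digit j (toℕ a)) a ≡ true
  own-block j a = cong₂ _∧_ (dec-true (parent j a ≟ parent j a) refl)
                            (dec-true (digit j (toℕ a) Fin.≟ digit j (toℕ a)) refl)

  other-block : ∀ j a b → shift j (toℕ b) ≢ shift j (toℕ a) → block j (parent j a) (digit j (toℕ a)) b ≡ false
  other-block j a b b≢a with parent j b ≟ parent j a
  ... | no  p≢ rewrite dec-false (parent j b ≟ parent j a) p≢ = refl
  ... | yes p≡ rewrite dec-true (parent j b ≟ parent j a) p≡
                     | dec-false (digit j (toℕ b) Fin.≟ digit j (toℕ a)) (λ d≡ → b≢a (shift-injective j d≡ p≡)) = refl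

  ∨-true : ∀ {x y} → x ≡ true ⊎ y ≡ true → x ∨ y ≡ true
  ∨-true {true}  _          = refl
  ∨-true {false} (inj₂ y≡t) = y≡t

  split-edge : ∀ j a b c → shift j (toℕ b) ≢ shift j (toℕ a) → shift j (toℕ c) ≢ shift j (toℕ a) →
               parent j b ≡ parent j a ⊎ parent j c ≡ parent j a →
               let g = split j (parent j a) (digit j (toℕ a)) in L g a ≡ true × R g b c ≡ true
  split-edge j a b c b≢a c≢a merged rewrite other-block j a b b≢a | other-block j a c c≢a =
    own-block j a , trans (∧-identityʳ _) (∨-true (Sum.map (dec-true (parent j b ≟ parent j a))
                                                           (dec-true (parent j c ≟ parent j a)) merged))

  levels-edge : ∀ {M} → n ≤ 2 ^ M → ∀ a b c → a ≢ b → a ≢ c →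
                Any (λ g → L g a ≡ true × R g b c ≡ true) (levels M)
  levels-edge {M} n≤2^M a b c a≢b a≢c =
    let j , j<M , ¬mergedⱼ , merged₁₊ⱼ = transition merged? M unmerged₀ mergedₘ in
    lose (∈-levels j<M (∈-level (digit j (toℕ a)) (parent<n j a)))
         (split-edge j a b c (¬mergedⱼ ∘ inj₁ ∘ sym) (¬mergedⱼ ∘ inj₂ ∘ sym) (Sum.map sym sym merged₁₊ⱼ))
    where
    merged : ℕ → Set
    merged i = shift i (toℕ a) ≡ shift i (toℕ b) ⊎ shift i (toℕ a) ≡ shift i (toℕ c)
    merged? : Decidable merged
    merged? i = (shift i (toℕ a) ≟ shift i (toℕ b)) ⊎-dec (shift i (toℕ a) ≟ shift i (toℕ c))
    unmerged₀ : ¬ merged 0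
    unmerged₀ = [ a≢b ∘ Fin.toℕ-injective , a≢c ∘ Fin.toℕ-injective ]′
    mergedₘ : merged M
    mergedₘ = inj₁ (trans (vanish a) (sym (vanish b)))
      where
      vanish : ∀ x → shift M (toℕ x) ≡ 0
      vanish x = shift-<2^ M (≤-trans (Fin.toℕ<n x) n≤2^M)

third : 3 ≤ n → (b c : Fin n) → ∃ λ a → a ≢ b × a ≢ c
third (s≤s (s≤s (s≤s _))) (Fin.suc b)           (Fin.suc c)           = 0F , (λ ()) , (λ ())
third (s≤s (s≤s (s≤s _))) 0F                    1F                    = 2F , (λ ()) , (λ ())
third (s≤s (s≤s (s≤s _))) 1F                    0F                    = 2F , (λ ()) , (λ ())
third (s≤s (s≤s (s≤s _))) 0F                    0F                    = 1F , (λ ()) , (λ ())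
third (s≤s (s≤s (s≤s _))) 0F                    (Fin.suc (Fin.suc c)) = 1F , (λ ()) , (λ ())
third (s≤s (s≤s (s≤s _))) (Fin.suc (Fin.suc b)) 0F                    = 1F , (λ ()) , (λ ())

levels-localCovering : ∀ {M} → 3 ≤ n → n ≤ 2 ^ M → LocalCovering n (4 * M)
levels-localCovering {n} {M} 3≤n n≤2^M = levels M , covering , countL≤ , (λ b c _ → countR-levels M b c)
  where
  open Levels n
  countL≤ : ∀ a → countL (levels M) a ≤ 4 * M
  countL≤ a = ≤-trans (countL-levels M a) (m≤n*m M 4)
  covering : IsCBCovering n (levels M)
  covering = record
    { coverSingleton = λ a → let b , b≢a , _ = third 3≤n a a in
                         Any.map proj₁ (levels-edge {M} n≤2^M a b b (b≢a ∘ sym) (b≢a ∘ sym))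
    ; coverPair      = λ b c _ → let a , a≢b , a≢c = third 3≤n b c in
                         Any.map proj₂ (levels-edge {M} n≤2^M a b c a≢b a≢c)
    ; coverEdge      = λ a b c _ → levels-edge {M} n≤2^M a b c
    }

-- Lower bound: the pairs {2i , 2i+1}

module DisjointPairs (n : ℕ) where

  m : ℕ
  m = ⌊ n /2⌋

  end : Fin m → Fin 2 → Fin n
  end i e = inject≤ (combine i e) (⌊n/2⌋*2≤n n)

  end-injective : ∀ {i j e f} → end i e ≡ end j f → i ≡ j × e ≡ f
  end-injective {i} {j} {e} {f} eq = ,-injective (begin
    (i , e)                  ≡⟨ Fin.remQuot-combine i e ⟨
    remQuot 2 (combine i e)  ≡⟨ cong (remQuot 2) (Fin.inject≤-injective _ _ _ _ eq) ⟩
    remQuot 2 (combine j f)  ≡⟨ Fin.remQuot-combine j f ⟩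
    (j , f)                  ∎)
    where open ≡-Reasoning

  toℕ-end : ∀ i e → toℕ (end i e) ≡ 2 * toℕ i + toℕ e
  toℕ-end i e = trans (Fin.toℕ-inject≤ (combine i e) _) (Fin.toℕ-combine i e)

  end0<end1 : ∀ i → end i 0F Fin.< end i 1F
  end0<end1 i = begin-strict
    toℕ (end i 0F) ≡⟨ toℕ-end i 0F ⟩
    2 * toℕ i + 0  <⟨ +-monoʳ-< (2 * toℕ i) z<s ⟩
    2 * toℕ i + 1  ≡⟨ toℕ-end i 1F ⟨
    toℕ (end i 1F) ∎
    where open ≤-Reasoning

⌊n/2⌋≤2^[k+k] : ∀ {k} (cs : List (Biclique n)) → IsCBCovering n cs → IsLocal k cs → ⌊ n /2⌋ ≤ 2 ^ (k + k)
⌊n/2⌋≤2^[k+k] {n} {k} cs covering (countL≤k , countR≤k) =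
  subst (_≤ 2 ^ (k + k)) (length-tabulate (λ i → i)) (crossing-length≤ cs k crossing bounded)
  where
  open DisjointPairs n
  open IsCBCovering covering

  α β : Fin m → Biclique n → Bool
  α i g = L g (end i 0F)
  β i g = R g (end i 0F) (end i 1F)

  disjoint : ∀ i g → α i g ≡ true → β i g ≡ false
  disjoint i g αig with β i g in βig
  ... | false = refl
  ... | true  = contradiction refl (proj₁ (complete g _ _ _ (end0<end1 i) αig βig))

  open CrossingPairs α β disjoint

  reaches : ∀ {i j} → i ≢ j → Reaches cs i j
  reaches i≢j = coverEdge _ _ _ (end0<end1 _) (i≢j ∘ proj₁ ∘ end-injective)
                          (λ eq → case proj₂ (end-injective eq) of λ ())

  crossing : AllPairs (Crossing cs) (allFin m)
  crossing = AllPairs.tabulate⁺ λ i≢j → reaches i≢j , reaches (i≢j ∘ sym)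

  bounded : All (λ i → count (α i) cs ≤ k × count (β i) cs ≤ k) (allFin m)
  bounded = All.tabulate⁺ λ i →
    subst (_≤ k) (countL≡count cs _) (countL≤k _) ,
    subst (_≤ k) (countR≡count cs _ _) (countR≤k _ _ (end0<end1 i))

⌊log₂n⌋≤3k : ∀ {k} (cs : List (Biclique n)) → 0 < n → IsCBCovering n cs → IsLocal k cs → ⌊log₂ n ⌋ ≤ 3 * k
⌊log₂n⌋≤3k {suc n} {k} cs _ covering local = begin
  ⌊log₂ suc n ⌋            ≤⟨ ⌊log₂n⌋≤1+⌊log₂⌊n/2⌋⌋ (suc n) ⟩
  suc ⌊log₂ ⌊ suc n /2⌋ ⌋  ≤⟨ s≤s (⌊log₂⌋-mono-≤ (⌊n/2⌋≤2^[k+k] cs covering local)) ⟩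
  suc ⌊log₂ 2 ^ (k + k) ⌋  ≡⟨ cong suc (⌊log₂[2^n]⌋≡n (k + k)) ⟩
  suc (k + k)              ≤⟨ 1+2k≤3k (≤-trans (1≤countL cs (coverSingleton 0F)) (proj₁ local 0F)) ⟩
  3 * k                    ∎
  where
  open ≤-Reasoning
  open IsCBCovering covering
  1+2k≤3k : ∀ {k} → 1 ≤ k → suc (k + k) ≤ 3 * k
  1+2k≤3k {suc j} _ = subst (suc (suc j + suc j) ≤_) (sym (3[1+j]≡3+2j+j j)) (m≤m+n _ j)
    where
    3[1+j]≡3+2j+j : ∀ j → 3 * suc j ≡ suc (suc j + suc j) + j
    3[1+j]≡3+2j+j = solve-∀

-- Existence of the least locality

Vertex : ℕ → Set
Vertex n = Fin n ⊎ (Fin n × Fin n)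

-- A pair is only a vertex when b < c, which is where R is meaningful.
_∋_ : Biclique n → Vertex n → Bool
g ∋ inj₁ a       = L g a
g ∋ inj₂ (b , c) = does (b Fin.<? c) ∧ R g b c

vertices : ∀ n → List (Vertex n)
vertices n = map inj₁ (allFin n) ++ map inj₂ (cartesianProduct (allFin n) (allFin n))

prune : List (Biclique n) → List (Biclique n)
prune = filterᵇ (meets _∋_ (vertices _))

module _ (cs : List (Biclique n)) where

  prune-covering : IsCBCovering n cs → IsCBCovering n (prune cs)
  prune-covering covering = record
    { coverSingleton = λ a → Any-filterᵇ _ (meets-singleton a) (coverSingleton a)
    ; coverPair      = λ b c b<c → Any-filterᵇ _ (meets-pair b<c) (coverPair b c b<c)
    ; coverEdge      = λ a b c b<c a≢b a≢c →
        Any-filterᵇ _ (meets-singleton a ∘ proj₁) (coverEdge a b c b<c a≢b a≢c)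
    }
    where
    open IsCBCovering covering
    meets-singleton : ∀ a {g} → L g a ≡ true → meets _∋_ (vertices n) g ≡ true
    meets-singleton a = meets-∈ _∋_ (∈-++⁺ˡ (∈-map⁺ inj₁ (∈-allFin a)))
    meets-pair : ∀ {b c g} → b Fin.< c → R g b c ≡ true → meets _∋_ (vertices n) g ≡ true
    meets-pair {b} {c} {g} b<c rbc = meets-∈ _∋_
      (∈-++⁺ʳ (map inj₁ (allFin n)) (∈-map⁺ inj₂ (∈-cartesianProduct⁺ (∈-allFin b) (∈-allFin c))))
      (trans (cong (_∧ R g b c) (dec-true (b Fin.<? c) b<c)) rbc)

  prune-local : ∀ {k} → IsLocal k cs → IsLocal k (prune cs)
  prune-local (countL≤k , countR≤k) =
    (λ a → ≤-trans (countL-filterᵇ _ cs a) (countL≤k a)) ,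
    (λ b c b<c → ≤-trans (countR-filterᵇ _ cs b c) (countR≤k b c b<c))

  length-prune≤ : ∀ {k} → IsLocal k cs → length (prune cs) ≤ length (vertices n) * k
  length-prune≤ {k} (countL≤k , countR≤k) = begin
    length (prune cs)                  ≡⟨ length-filterᵇ _ cs ⟩
    count (meets _∋_ (vertices n)) cs  ≤⟨ count-meets≤ _∋_ (vertices n) cs (All.tabulate λ {v} _ → multiplicity≤k v) ⟩
    length (vertices n) * k            ∎
    where
    open ≤-Reasoning
    multiplicity≤k : ∀ v → count (_∋ v) cs ≤ k
    multiplicity≤k (inj₁ a) = subst (_≤ k) (countL≡count cs a) (countL≤k a)
    multiplicity≤k (inj₂ (b , c)) with b Fin.<? c
    ... | yes b<c rewrite dec-true (b Fin.<? c) b<c = subst (_≤ k) (countR≡count cs b c) (countR≤k b c b<c)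
    ... | no  b≮c rewrite dec-false (b Fin.<? c) b≮c = ≤-trans (≤-reflexive (count-false cs)) z≤n

Code : ℕ → Set
Code n = Subset n × Subset (n * n)

decode : Code n → Biclique n
decode (l , r) = biclique (lookup l) (λ b c → lookup r (combine b c))

encode : Biclique n → Code n
encode {n} g = tabulate (L g) , tabulate (uncurry (R g) ∘ remQuot n)

≈-decode-encode : (g : Biclique n) → g ≈ decode (encode g)
≈-decode-encode {n} g =
  L≡ , λ b c b<c → trans (proj₂ (biclique-L-R g) b c b<c) (proj₂ (biclique-cong L≡ R≡) b c b<c)
  where
  L≡ : ∀ a → L g a ≡ lookup (tabulate (L g)) a
  L≡ a = sym (lookup∘tabulate (L g) a)
  R≡ : ∀ b c → R g b c ≡ lookup (tabulate (uncurry (R g) ∘ remQuot n)) (combine b c)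
  R≡ b c = sym (trans (lookup∘tabulate _ (combine b c)) (cong (uncurry (R g)) (Fin.remQuot-combine b c)))

≈-decode-encode* : (cs : List (Biclique n)) → Pointwise _≈_ cs (map decode (map encode cs))
≈-decode-encode* []       = Pointwise.[]
≈-decode-encode* (g ∷ cs) = ≈-decode-encode g Pointwise.∷ ≈-decode-encode* cs

searchable-Code : Searchable (Code n)
searchable-Code = searchable-× anySubset? anySubset?

covering? : (cs : List (Biclique n)) → Dec (IsCBCovering n cs)
covering? {n} cs = map′ (λ (s , p , e) → record { coverSingleton = s ; coverPair = p ; coverEdge = e })
                        (λ cov → coverSingleton cov , coverPair cov , coverEdge cov)
                        (singletons? ×-dec pairs? ×-dec edges?)
  where
  open IsCBCovering
  member? : (p : Biclique n → Bool) → Dec (Any (λ g → p g ≡ true) cs)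
  member? p = Any.any? (λ g → p g Bool.≟ true) cs
  singletons? : Dec (∀ a → Any (λ g → L g a ≡ true) cs)
  singletons? = Fin.all? λ a → member? (λ g → L g a)
  pairs? : Dec (∀ b c → b Fin.< c → Any (λ g → R g b c ≡ true) cs)
  pairs? = Fin.all? λ b → Fin.all? λ c → b Fin.<? c →-dec member? (λ g → R g b c)
  edges? : Dec (∀ a b c → b Fin.< c → a ≢ b → a ≢ c → Any (λ g → L g a ≡ true × R g b c ≡ true) cs)
  edges? = Fin.all? λ a → Fin.all? λ b → Fin.all? λ c →
             b Fin.<? c →-dec ¬? (a Fin.≟ b) →-dec ¬? (a Fin.≟ c) →-dec
             Any.any? (λ g → (L g a Bool.≟ true) ×-dec (R g b c Bool.≟ true)) cs

local? : ∀ k (cs : List (Biclique n)) → Dec (IsLocal k cs)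
local? k cs = Fin.all? (λ a → countL cs a ≤? k) ×-dec
              Fin.all? λ b → Fin.all? λ c → b Fin.<? c →-dec countR cs b c ≤? k

localCovering? : ∀ n k → Dec (LocalCovering n k)
localCovering? n k = map′ (λ (xs , _ , covering-local) → map decode xs , covering-local) normalForm
  (search-length≤ searchable-Code (length (vertices n) * k)
                  λ xs → covering? (map decode xs) ×-dec local? k (map decode xs))
  where
  normalForm : LocalCovering n k → ∃ λ xs → length xs ≤ length (vertices n) * k ×
                 IsCBCovering n (map decode xs) × IsLocal k (map decode xs)
  normalForm (cs , covering , local) =
    map encode (prune cs) ,
    subst (_≤ _) (sym (length-map encode (prune cs))) (length-prune≤ cs local) ,
    Pointwise-covering (≈-decode-encode* (prune cs)) (prune-covering cs covering) ,
    Pointwise-local (≈-decode-encode* (prune cs)) (prune-local cs local)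

lc-exists : ∀ {k} → LocalCovering n k → ∃ λ lc → IsLcCB n lc × lc ≤ k
lc-exists {n} covering with least (localCovering? n) covering
... | lc , lcCovering , minimal = lc , (lcCovering , λ cs k cov loc → minimal (cs , cov , loc)) , minimal covering

theorem10 : Σ ℕ λ c₁ → Σ ℕ λ c₂ → Σ ℕ λ N → ∀ n → N ≤ n →
              Σ ℕ λ k → IsLcCB n k × (⌊log₂ n ⌋ ≤ c₁ * k) × (k ≤ c₂ * ⌊log₂ n ⌋)
theorem10 = 3 , 8 , 3 , bounds
  where
  bounds : ∀ n → 3 ≤ n → Σ ℕ λ k → IsLcCB n k × (⌊log₂ n ⌋ ≤ 3 * k) × (k ≤ 8 * ⌊log₂ n ⌋)
  bounds n 3≤n with lc-exists (levels-localCovering 3≤n (<⇒≤ (n<2^[1+⌊log₂n⌋] n)))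
  ... | k , isLc@((cs , covering , local) , _) , k≤4[1+log₂n] =
    k , isLc , ⌊log₂n⌋≤3k cs (≤-trans (s≤s z≤n) 3≤n) covering local ,
    ≤-trans k≤4[1+log₂n] (4[1+m]≤8m (1≤⌊log₂n⌋ (≤-trans (s≤s (s≤s z≤n)) 3≤n)))
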